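{- The complete graph $K_3$ is a difference graph. Moreover, a set $S$ of positive integers is a signature of $K_3$ if and only if $S=\{a,2a,3a\}$ for some positive integer $a$.
   Context: A graph $G=(V,E)$ is a difference graph if there is a bijection $f$ from $V$ onto a set $S$ of positive integers such that for all distinct $x,y\in V$: $xy\in E$ if and only if $|f(x)-f(y)|\in S$; $S$ is called a signature of $G$. -}

module Defs where

open import Data.Nat using (ℕ; _<_; ∣_-_∣)
open import Data.Fin using (Fin)
open import Data.Product using (∃)
open import Relation.Binary.PropositionalEquality using (_≡_)
open import Relation.Nullary using (¬_)
open import Function.Bundles using (_⇔_)

Graph : ℕ → Set₁
Graph n = Fin n → Fin n → Set

K : (n : ℕ) → Graph n
K n x y = ¬ (x ≡ y)

record IsSignature {n : ℕ} (G : Graph n) (S : ℕ → Set) : Set where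
  field
    f        : Fin n → ℕ
    f-inj    : ∀ x y → f x ≡ f y → x ≡ y
    f-into   : ∀ x → S (f x)
    f-onto   : ∀ s → S s → ∃ λ x → f x ≡ s
    positive : ∀ s → S s → 0 < s
    adj      : ∀ x y → ¬ (x ≡ y) → (G x y ⇔ S ∣ f x - f y ∣)

IsDifferenceGraph : {n : ℕ} → Graph n → Set₁
IsDifferenceGraph G = ∃ λ (S : ℕ → Set) → IsSignature G S

{-# OPTIONS --safe #-}
module Submission where

-- If S = {x < y < z} is a signature of K₃, then y − x and z − x are again
-- elements of S. Since x > 0, y − x is smaller than y and z, so y − x = x;
-- and z − x is smaller than z and differs from x (else z = y), so z − x = y.
-- Hence S = {x, 2x, 3x}. Conversely {a, 2a, …, na} is a signature of Kₙ for
-- every n, because the differences of its elements are a, …, (n − 1)a.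

open import Defs
open import Data.Nat using (ℕ; NonZero; >-nonZero; suc; _+_; _*_; _∸_; _≤_; _<_; _⊔_; z<s; ∣_-_∣)
open import Data.Nat.Properties
open import Data.Fin using (Fin; toℕ; fromℕ<)
open import Data.Fin.Patterns using (0F; 1F; 2F)
open import Data.Fin.Properties using (toℕ-injective; toℕ<n; toℕ-fromℕ<)
open import Data.Product using (_×_; ∃; _,_; proj₁; proj₂)
import Data.Sum as Sum
open import Data.Sum using (_⊎_; inj₁; inj₂)
open import Relation.Binary.Definitions using (tri<; tri≈; tri>)
open import Relation.Binary.PropositionalEquality
  using (_≡_; _≢_; refl; sym; cong; subst; subst₂; trans; module ≡-Reasoning)
open import Relation.Nullary using (contradiction)
open import Function.Bundles using (_⇔_; mk⇔; Equivalence)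
import Function.Properties.Equivalence as ⇔

open Equivalence using (to; from)

Among : {A : Set} → A → A → A → A → Set
Among x y z s = s ≡ x ⊎ s ≡ y ⊎ s ≡ z

Among-map : {A B : Set} {x y z s : A} (g : A → B) →
            Among x y z s → Among (g x) (g y) (g z) (g s)
Among-map g = Sum.map (cong g) (Sum.map (cong g) (cong g))

IsSignature-resp-⇔ : ∀ {n} {G : Graph n} {S T : ℕ → Set} →
                     (∀ s → S s ⇔ T s) → IsSignature G S → IsSignature G T
IsSignature-resp-⇔ {S = S} {T} S⇔T σ = record
  { f        = f
  ; f-inj    = f-inj
  ; f-into   = λ x → to (S⇔T _) (f-into x)
  ; f-onto   = λ s Ts → f-onto s (from (S⇔T s) Ts)
  ; positive = λ s Ts → positive s (from (S⇔T s) Ts)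
  ; adj      = λ x y x≢y → ⇔.trans (adj x y x≢y) (S⇔T _)
  }
  where open IsSignature σ

Multiples : ℕ → ℕ → ℕ → Set
Multiples n a s = ∃ λ (i : Fin n) → s ≡ suc (toℕ i) * a

∣i-j∣≡suc[k] : ∀ {n} (i j : Fin n) → i ≢ j →
               ∃ λ (k : Fin n) → ∣ toℕ i - toℕ j ∣ ≡ suc (toℕ k)
∣i-j∣≡suc[k] {n} i j i≢j with ∣ toℕ i - toℕ j ∣ in eq
... | 0     = contradiction (toℕ-injective (∣m-n∣≡0⇒m≡n eq)) i≢j
... | suc d = fromℕ< d<n , cong suc (sym (toℕ-fromℕ< d<n))
  where
  d<n : d < n
  d<n = <⇒≤ (≤-<-trans (subst (_≤ toℕ i ⊔ toℕ j) eq (∣m-n∣≤m⊔n (toℕ i) (toℕ j)))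
                        (⊔-lub (toℕ<n i) (toℕ<n j)))

Multiples-isSignature : ∀ n {a} → 0 < a → IsSignature (K n) (Multiples n a)
Multiples-isSignature n {a} 0<a = record
  { f        = f
  ; f-inj    = f-inj
  ; f-into   = λ i → i , refl
  ; f-onto   = λ { s (i , s≡f[i]) → i , sym s≡f[i] }
  ; positive = λ { s (i , refl) → <-≤-trans 0<a (m≤n*m a (suc (toℕ i))) }
  ; adj      = λ i j i≢j → mk⇔ (λ _ → gap i j i≢j) (λ _ → i≢j)
  }
  where
  instance
    a≢0 : NonZero a
    a≢0 = >-nonZero 0<a

  f : Fin n → ℕ
  f i = suc (toℕ i) * a

  f-inj : ∀ i j → f i ≡ f j → i ≡ j
  f-inj i j e = toℕ-injective (suc-injective (*-cancelʳ-≡ (suc (toℕ i)) (suc (toℕ j)) a e))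

  gap : ∀ i j → i ≢ j → Multiples n a ∣ f i - f j ∣
  gap i j i≢j with ∣i-j∣≡suc[k] i j i≢j
  ... | k , ∣i-j∣≡1+k = k , (begin
    ∣ f i - f j ∣                     ≡⟨ *-distribʳ-∣-∣ a (suc (toℕ i)) (suc (toℕ j)) ⟨
    ∣ toℕ i - toℕ j ∣ * a             ≡⟨ cong (_* a) ∣i-j∣≡1+k ⟩
    suc (toℕ k) * a                   ∎)
    where open ≡-Reasoning

Multiples-3⇔Among : ∀ a s → Multiples 3 a s ⇔ Among a (2 * a) (3 * a) s
Multiples-3⇔Among a s = mk⇔ forth back
  where
  forth : Multiples 3 a s → Among a (2 * a) (3 * a) s
  forth (0F , e) = inj₁ (trans e (*-identityˡ a))
  forth (1F , e) = inj₂ (inj₁ e)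
  forth (2F , e) = inj₂ (inj₂ e)

  back : Among a (2 * a) (3 * a) s → Multiples 3 a s
  back (inj₁ e)        = 0F , trans e (sym (*-identityˡ a))
  back (inj₂ (inj₁ e)) = 1F , e
  back (inj₂ (inj₂ e)) = 2F , e

record Ascending (f : Fin 3 → ℕ) : Set where
  field
    lo mid hi  : Fin 3
    lo<mid     : f lo < f mid
    mid<hi     : f mid < f hi
    exhaustive : ∀ i → Among lo mid hi i

ascending : (f : Fin 3 → ℕ) → (∀ i j → f i ≡ f j → i ≡ j) → Ascending f
ascending f f-inj with <-cmp (f 0F) (f 1F) | <-cmp (f 1F) (f 2F) | <-cmp (f 0F) (f 2F)
... | tri≈ _ e _ | _          | _          = contradiction (f-inj 0F 1F e) λ ()
... | _          | tri≈ _ e _ | _          = contradiction (f-inj 1F 2F e) λ ()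
... | _          | _          | tri≈ _ e _ = contradiction (f-inj 0F 2F e) λ ()
... | tri< 0<1 _ _ | tri< 1<2 _ _ | _ =
  record { lo = 0F ; mid = 1F ; hi = 2F ; lo<mid = 0<1 ; mid<hi = 1<2
         ; exhaustive = λ { 0F → inj₁ refl ; 1F → inj₂ (inj₁ refl) ; 2F → inj₂ (inj₂ refl) } }
... | tri< 0<1 _ _ | tri> _ _ 2<1 | tri< 0<2 _ _ =
  record { lo = 0F ; mid = 2F ; hi = 1F ; lo<mid = 0<2 ; mid<hi = 2<1
         ; exhaustive = λ { 0F → inj₁ refl ; 1F → inj₂ (inj₂ refl) ; 2F → inj₂ (inj₁ refl) } }
... | tri< 0<1 _ _ | tri> _ _ 2<1 | tri> _ _ 2<0 =
  record { lo = 2F ; mid = 0F ; hi = 1F ; lo<mid = 2<0 ; mid<hi = 0<1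
         ; exhaustive = λ { 0F → inj₂ (inj₁ refl) ; 1F → inj₂ (inj₂ refl) ; 2F → inj₁ refl } }
... | tri> _ _ 1<0 | tri< 1<2 _ _ | tri< 0<2 _ _ =
  record { lo = 1F ; mid = 0F ; hi = 2F ; lo<mid = 1<0 ; mid<hi = 0<2
         ; exhaustive = λ { 0F → inj₂ (inj₁ refl) ; 1F → inj₁ refl ; 2F → inj₂ (inj₂ refl) } }
... | tri> _ _ 1<0 | tri< 1<2 _ _ | tri> _ _ 2<0 =
  record { lo = 1F ; mid = 2F ; hi = 0F ; lo<mid = 1<2 ; mid<hi = 2<0
         ; exhaustive = λ { 0F → inj₂ (inj₂ refl) ; 1F → inj₁ refl ; 2F → inj₂ (inj₁ refl) } }
... | tri> _ _ 1<0 | tri> _ _ 2<1 | _ =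
  record { lo = 2F ; mid = 1F ; hi = 0F ; lo<mid = 2<1 ; mid<hi = 1<0
         ; exhaustive = λ { 0F → inj₂ (inj₂ refl) ; 1F → inj₂ (inj₁ refl) ; 2F → inj₁ refl } }

gaps-among⇒y≡2x∧z≡3x : ∀ {x y z} → 0 < x → x < y → y < z →
                       Among x y z (y ∸ x) → Among x y z (z ∸ x) →
                       y ≡ 2 * x × z ≡ 3 * x
gaps-among⇒y≡2x∧z≡3x {x} {y} {z} 0<x x<y y<z y∸x∈ z∸x∈ = y≡2x , z≡3x
  where
  open ≡-Reasoning
  x≤y : x ≤ y
  x≤y = <⇒≤ x<y
  x≤z : x ≤ z
  x≤z = <⇒≤ (<-trans x<y y<z)
  y∸x<y : y ∸ x < y
  y∸x<y = ∸-monoʳ-< 0<x x≤y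
  z∸x<z : z ∸ x < z
  z∸x<z = ∸-monoʳ-< 0<x x≤z

  y∸x≡x : y ∸ x ≡ x
  y∸x≡x = smallest y∸x∈
    where
    smallest : Among x y z (y ∸ x) → y ∸ x ≡ x
    smallest (inj₁ e)        = e
    smallest (inj₂ (inj₁ e)) = contradiction e (<⇒≢ y∸x<y)
    smallest (inj₂ (inj₂ e)) = contradiction e (<⇒≢ (<-trans y∸x<y y<z))

  z∸x≡y : z ∸ x ≡ y
  z∸x≡y = middle z∸x∈
    where
    middle : Among x y z (z ∸ x) → z ∸ x ≡ y
    middle (inj₁ e)        = contradiction (∸-cancelʳ-≡ x≤z x≤y (trans e (sym y∸x≡x))) (>⇒≢ y<z)
    middle (inj₂ (inj₁ e)) = e
    middle (inj₂ (inj₂ e)) = contradiction e (<⇒≢ z∸x<z)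

  y≡2x : y ≡ 2 * x
  y≡2x = begin
    y          ≡⟨ m∸n+n≡m x≤y ⟨
    y ∸ x + x  ≡⟨ cong (_+ x) y∸x≡x ⟩
    x + x      ≡⟨ cong (x +_) (+-identityʳ x) ⟨
    2 * x      ∎

  z≡3x : z ≡ 3 * x
  z≡3x = begin
    z          ≡⟨ m∸n+n≡m x≤z ⟨
    z ∸ x + x  ≡⟨ cong (_+ x) z∸x≡y ⟩
    y + x      ≡⟨ cong (_+ x) y≡2x ⟩
    2 * x + x  ≡⟨ +-comm (2 * x) x ⟩
    3 * x      ∎

K3-signature⇒multiples : ∀ {S} → IsSignature (K 3) S →
                          ∃ λ a → 0 < a × (∀ s → S s ⇔ Among a (2 * a) (3 * a) s)
K3-signature⇒multiples {S} σ = x , positive x (f-into lo) , λ s → mk⇔ forth (back s)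
  where
  open IsSignature σ
  open Ascending (ascending f f-inj)
  x y z : ℕ
  x = f lo
  y = f mid
  z = f hi

  S⊆xyz : ∀ {s} → S s → Among x y z s
  S⊆xyz {s} Ss with f-onto s Ss
  ... | i , refl = Among-map f (exhaustive i)

  gap : ∀ {i j} → f i < f j → S (f j ∸ f i)
  gap {i} {j} fi<fj = subst S (m≤n⇒∣m-n∣≡n∸m (<⇒≤ fi<fj)) (to (adj i j i≢j) i≢j)
    where
    i≢j : i ≢ j
    i≢j i≡j = <⇒≢ fi<fj (cong f i≡j)

  y≡2x×z≡3x : y ≡ 2 * x × z ≡ 3 * x
  y≡2x×z≡3x = gaps-among⇒y≡2x∧z≡3x (positive x (f-into lo)) lo<mid mid<hi
                (S⊆xyz (gap lo<mid)) (S⊆xyz (gap (<-trans lo<mid mid<hi)))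

  xyz⊆S : ∀ {s} → Among x y z s → S s
  xyz⊆S (inj₁ refl)        = f-into lo
  xyz⊆S (inj₂ (inj₁ refl)) = f-into mid
  xyz⊆S (inj₂ (inj₂ refl)) = f-into hi

  forth : ∀ {s} → S s → Among x (2 * x) (3 * x) s
  forth {s} Ss =
    subst₂ (λ u v → Among x u v s) (proj₁ y≡2x×z≡3x) (proj₂ y≡2x×z≡3x) (S⊆xyz Ss)

  back : ∀ s → Among x (2 * x) (3 * x) s → S s
  back s s∈ = xyz⊆S
    (subst₂ (λ u v → Among x u v s) (sym (proj₁ y≡2x×z≡3x)) (sym (proj₂ y≡2x×z≡3x)) s∈)

multiples⇒K3-signature : ∀ {S} → (∃ λ a → 0 < a × (∀ s → S s ⇔ Among a (2 * a) (3 * a) s)) →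
                          IsSignature (K 3) S
multiples⇒K3-signature (a , 0<a , S⇔) =
  IsSignature-resp-⇔ (λ s → ⇔.trans (Multiples-3⇔Among a s) (⇔.sym (S⇔ s)))
                     (Multiples-isSignature 3 0<a)

theorem3p1 : IsDifferenceGraph (K 3)
    × ((S : ℕ → Set) → (∀ s → S s → 0 < s)
    → (IsSignature (K 3) S
    ⇔ ∃ λ (a : ℕ) → 0 < a × (∀ s → (S s ⇔ (s ≡ a ⊎ s ≡ 2 * a ⊎ s ≡ 3 * a)))))
theorem3p1 = (Multiples 3 1 , Multiples-isSignature 3 z<s)
           , λ S _ → mk⇔ K3-signature⇒multiples multiples⇒K3-signature
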